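{- Let $H$ be an instance hypergraph of MTRS-minDist (as described in the context) satisfying: $|\Delta|=|R|$ and for every $\eta\in\Delta$ and every $r\in R$, $\{\eta,r\}$ is an edge of $H$. Then Algorithm GreedyMinDist terminates and outputs a feasible solution, i.e. a set $M$ of edges of $H$ that are pairwise vertex-disjoint and such that every rider of $R$ lies in some edge of $M$.
   Context: An instance of MTRS-minDist: finite sets $R$ (riders) and $D=\Gamma\cup\Delta$ (drivers, personal and designated, $\Gamma\cap\Delta=\emptyset$); a hypergraph $H$ with vertex set $D\cup R$ whose edges (feasible matches) are sets $\{\eta\}\cup S$ with $\eta\in D$, $\emptyset\neq S\subseteq R$, $|S|\le\lambda_\eta$ (the capacity of $\eta$), each edge $e$ having a positive integer weight $w(e)$; for an edge $e=\{\eta\}\cup S$ write $D(e)=\eta$, $R(e)=S$. Algorithm GreedyMinDist computes two sets $M_1,M_2$ and outputs the one of smaller total weight. $M_1$: start with $M_1=\emptyset$ and the original $H$; repeatedly select an edge $e$ of the current hypergraph with minimum $w(e)$, add it to $M_1$, and delete all vertices of $e$ and all edges containing any vertex of $e$; stop when every rider is covered by $M_1$. $M_2$: the same procedure, starting from the original $H$, but selecting in each iteration an edge minimizing $w(e)/|R(e)|$. -}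

module Defs where

open import Data.Nat using (ℕ; zero; suc; _+_; _*_; _≤_; _<_; _≤?_)
open import Data.Bool using (Bool; true; false; not; _∨_; if_then_else_)
import Data.Bool as B
open import Data.Fin using (Fin)
import Data.Fin as F
open import Data.Fin.Subset using (Subset; ⊤; ⊥; _∩_; _∪_; ∣_∣; Nonempty)
import Data.Fin.Subset as SS
open import Data.List using (List; []; _∷_; length; filterᵇ; head; foldr)
import Data.List.Membership.Propositional as LM
open import Data.List.Relation.Unary.All using (All)
open import Data.List.Relation.Unary.Any using (Any)
open import Data.List.Relation.Unary.AllPairs using (AllPairs)
open import Data.Maybe using (Maybe; just; nothing; _>>=_)
open import Data.Product using (_×_)
open import Data.Vec.Properties using (≡-dec)
open import Relation.Binary.PropositionalEquality using (_≡_; _≢_)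
open import Relation.Nullary using (¬_)
open import Relation.Nullary.Decidable using (⌊_⌋)

record Edge (nR nD : ℕ) : Set where
  constructor mkEdge
  field
    driver : Fin nD
    riders : Subset nR
    weight : ℕ
open Edge public

module _ {nR nD : ℕ} where

  WellFormed : (Fin nD → ℕ) → List (Edge nR nD) → Set
  WellFormed cap H =
    All (λ e → Nonempty (riders e) × ∣ riders e ∣ ≤ cap (driver e) × 0 < weight e) H
    × AllPairs (λ e f → ¬ (driver e ≡ driver f × riders e ≡ riders f)) H

  VertexDisjoint : Edge nR nD → Edge nR nD → Set
  VertexDisjoint e f = driver e ≢ driver f × SS.Empty (riders e ∩ riders f)

  Feasible : List (Edge nR nD) → List (Edge nR nD) → Set
  Feasible H M =
    All (λ e → e LM.∈ H) M
    × AllPairs VertexDisjoint M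
    × (∀ (r : Fin nR) → Any (λ e → r SS.∈ riders e) M)

  _≟S_ : (s t : Subset nR) → _
  _≟S_ = ≡-dec B._≟_

  coveredBy : List (Edge nR nD) → Subset nR
  coveredBy = foldr (λ e s → riders e ∪ s) ⊥

  allCovered : List (Edge nR nD) → Bool
  allCovered M = ⌊ coveredBy M ≟S ⊤ ⌋

  conflicts : Edge nR nD → Edge nR nD → Bool
  conflicts e f = ⌊ driver e F.≟ driver f ⌋ ∨ not ⌊ (riders e ∩ riders f) ≟S ⊥ ⌋

  leWeight : Edge nR nD → Edge nR nD → Bool
  leWeight e f = ⌊ weight e ≤? weight f ⌋

  -- w(e)/|R(e)| ≤ w(f)/|R(f)|, by cross-multiplication (|R(·)| > 0)
  leRatio : Edge nR nD → Edge nR nD → Bool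
  leRatio e f = ⌊ weight e * ∣ riders f ∣ ≤? weight f * ∣ riders e ∣ ⌋

  allᵇ : (Edge nR nD → Bool) → List (Edge nR nD) → Bool
  allᵇ p = foldr (λ x b → p x B.∧ b) true

  minimizers : (Edge nR nD → Edge nR nD → Bool) → List (Edge nR nD) → List (Edge nR nD)
  minimizers le cur = filterᵇ (λ e → allᵇ (le e) cur) cur

  nth : List (Edge nR nD) → ℕ → Maybe (Edge nR nD)
  nth []       _       = nothing
  nth (x ∷ xs) zero    = just x
  nth (x ∷ xs) (suc k) = nth xs k

  -- tie-breaking: choose the i-th minimizer (the first one if i is out of range)
  pickIdx : ℕ → List (Edge nR nD) → Maybe (Edge nR nD)
  pickIdx i xs with nth xs i
  ... | just e  = just e
  ... | nothing = head xs

  -- One run of the greedy loop. tb k is the tie-breaking index used in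
  -- iteration k. Result nothing = the algorithm gets stuck (no edge left while
  -- some rider is uncovered) or exceeds the fuel. Each iteration removes at
  -- least the selected edge, so fuel = |E(H)| never runs out on its own.
  greedyLoop : (Edge nR nD → Edge nR nD → Bool) → (ℕ → ℕ) → ℕ → ℕ
             → List (Edge nR nD) → List (Edge nR nD) → Maybe (List (Edge nR nD))
  greedyLoop le tb fuel it cur M with allCovered M
  ... | true  = just M
  ... | false with fuel
  ...   | zero = nothing
  ...   | suc fuel' with pickIdx (tb it) (minimizers le cur)
  ...     | nothing = nothing
  ...     | just e  = greedyLoop le tb fuel' (suc it)
                        (filterᵇ (λ f → not (conflicts e f)) cur) (e ∷ M)

  greedyRun : (Edge nR nD → Edge nR nD → Bool) → (ℕ → ℕ) → List (Edge nR nD)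
            → Maybe (List (Edge nR nD))
  greedyRun le tb H = greedyLoop le tb (length H) 0 H []

  totalWeight : List (Edge nR nD) → ℕ
  totalWeight = foldr (λ e s → weight e + s) 0

  GreedyMinDist : (ℕ → ℕ) → (ℕ → ℕ) → List (Edge nR nD) → Maybe (List (Edge nR nD))
  GreedyMinDist tb1 tb2 H =
    greedyRun leWeight tb1 H >>= λ M₁ →
    greedyRun leRatio tb2 H >>= λ M₂ →
    just (if ⌊ totalWeight M₁ ≤? totalWeight M₂ ⌋ then M₁ else M₂)

-- While some rider r is uncovered, fewer than |R| = |Δ| riders are covered. Every
-- selected edge uses one driver and covers at least one rider not covered before, so
-- fewer than |Δ| drivers are used and some designated driver η is still free. The
-- current hypergraph is exactly the set of edges of H vertex-disjoint from the selected
-- ones, so it still contains {η, r}. Hence a greedy run never gets stuck: both selection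
-- keys are total preorders on edges (the ratio one because |R(e)| > 0), so a minimizing
-- edge exists, and every iteration deletes the selected edge, so |E(H)| iterations
-- suffice. The selected edges are pairwise disjoint by construction.

module Submission where

open import Defs
open import Data.Nat using (ℕ)
open import Data.Fin using (Fin)
open import Data.Fin.Subset using (Subset; ∣_∣; ⁅_⁆; _∈_)
open import Data.List using (List)
import Data.List.Membership.Propositional as LM
open import Data.Maybe using (just)
open import Data.Product using (_×_; ∃-syntax)
open import Relation.Binary.PropositionalEquality using (_≡_)

open import Data.Bool using (Bool; true; false; not; T)
open import Data.Empty using (⊥-elim)
import Data.Fin as F
open import Data.Fin.Properties using (¬∀⟶∃¬)
open import Data.Fin.Subset using (⊤; ⊥; _∪_; _∩_; _⊂_; _∉_; Nonempty; Empty; inside; outside)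
open import Data.Fin.Subset.Properties
open import Data.List using ([]; _∷_; foldr; length; filterᵇ)
open import Data.List.Membership.Propositional.Properties using (∈-filter⁺; ∈-filter⁻; ∈-length)
open import Data.List.Properties using (filter-notAll)
open import Data.List.Relation.Binary.Subset.Propositional renaming (_⊆_ to _⊆ₗ_)
open import Data.List.Relation.Unary.All as All using (All; []; _∷_)
open import Data.List.Relation.Unary.All.Properties using (¬Any⇒All¬; All¬⇒¬Any)
open import Data.List.Relation.Unary.AllPairs using (AllPairs; _∷_; [])
open import Data.List.Relation.Unary.Any using (Any; here; there)
open import Data.Maybe using (Maybe; nothing)
open import Data.Nat using (zero; suc; _+_; _*_; _≤_; _<_; _≤?_; z≤n; s≤s; NonZero; >-nonZero)
open import Data.Nat.Properties
open import Algebra.Properties.CommutativeSemigroup *-commutativeSemigroup using (xy∙z≈xz∙y)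
open import Data.Product using (_,_; proj₁; proj₂)
open import Data.Sum using (_⊎_; inj₁; inj₂; [_,_])
import Data.Sum as Sum
import Data.Unit as Unit
open import Data.Unit using (tt)
open import Data.Vec using ([]; _∷_; here; there)
open import Function using (_∘_; id)
open import Relation.Binary.PropositionalEquality using (_≢_; refl; sym; trans; cong; subst)
open import Relation.Nullary using (Dec; yes; no; ¬_)
open import Relation.Nullary.Decidable using (⌊_⌋; toWitness; fromWitness; T?)

∣p∪q∣≤∣p∣+∣q∣ : ∀ {n} (p q : Subset n) → ∣ p ∪ q ∣ ≤ ∣ p ∣ + ∣ q ∣
∣p∪q∣≤∣p∣+∣q∣ []            []            = z≤n
∣p∪q∣≤∣p∣+∣q∣ (outside ∷ p) (outside ∷ q) = ∣p∪q∣≤∣p∣+∣q∣ p q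
∣p∪q∣≤∣p∣+∣q∣ (outside ∷ p) (inside  ∷ q) =
  ≤-trans (s≤s (∣p∪q∣≤∣p∣+∣q∣ p q)) (≤-reflexive (sym (+-suc ∣ p ∣ ∣ q ∣)))
∣p∪q∣≤∣p∣+∣q∣ (inside  ∷ p) (outside ∷ q) = s≤s (∣p∪q∣≤∣p∣+∣q∣ p q)
∣p∪q∣≤∣p∣+∣q∣ (inside  ∷ p) (inside  ∷ q) =
  s≤s (≤-trans (∣p∪q∣≤∣p∣+∣q∣ p q) (+-monoʳ-≤ ∣ p ∣ (n≤1+n ∣ q ∣)))

∃∈q∖p-there : ∀ {n b c} {p q : Subset n} → ∃[ x ] (x ∈ q × x ∉ p) → ∃[ x ] (x ∈ c ∷ q × x ∉ b ∷ p)
∃∈q∖p-there (x , x∈q , x∉p) = F.suc x , there x∈q , λ { (there x∈p) → x∉p x∈p }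

∣p∣<∣q∣⇒∃∈q∖p : ∀ {n} {p q : Subset n} → ∣ p ∣ < ∣ q ∣ → ∃[ x ] (x ∈ q × x ∉ p)
∣p∣<∣q∣⇒∃∈q∖p {p = outside ∷ p} {inside  ∷ q} _         = F.zero , here , λ ()
∣p∣<∣q∣⇒∃∈q∖p {p = inside  ∷ p} {inside  ∷ q} (s≤s p<q) = ∃∈q∖p-there (∣p∣<∣q∣⇒∃∈q∖p p<q)
∣p∣<∣q∣⇒∃∈q∖p {p = b       ∷ p} {outside ∷ q} p<q       =
  ∃∈q∖p-there (∣p∣<∣q∣⇒∃∈q∖p (≤-trans (s≤s (∣p∣≤∣x∷p∣ b p)) p<q))

x∉p⇒∣p∣<n : ∀ {n} {p : Subset n} {x} → x ∉ p → ∣ p ∣ < n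
x∉p⇒∣p∣<n {n} {p} {x} x∉p = subst (∣ p ∣ <_) (∣⊤∣≡n n) (p⊂q⇒∣p∣<∣q∣ (⊆⊤ , x , ∈⊤ , x∉p))

Nonempty⇒0<∣p∣ : ∀ {n} {p : Subset n} → Nonempty p → 0 < ∣ p ∣
Nonempty⇒0<∣p∣ (x , x∈p) = ≤-trans (s≤s z≤n) (x∈p⇒∣p-x∣<∣p∣ x∈p)

module _ {A : Set} (le : A → A → Bool) {P : A → Set}
  (le-total : ∀ {a b} → P a → P b → T (le a b) ⊎ T (le b a))
  (le-trans : ∀ {a b c} → P a → P b → P c → T (le a b) → T (le b c) → T (le a c)) where

  le-refl : ∀ {a} → P a → T (le a a)
  le-refl pa = [ id , id ] (le-total pa pa)

  least-exists : ∀ {x xs} → All P (x ∷ xs) → ∃[ m ] (m LM.∈ x ∷ xs × All (T ∘ le m) (x ∷ xs))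
  least-exists {x} {[]} (px ∷ []) = x , here refl , le-refl px ∷ []
  least-exists {x} {y ∷ ys} (px ∷ pys) with least-exists pys
  ... | m , m∈ , m≤ with le-total px (All.lookup pys m∈)
  ...   | inj₁ x≤m = x , here refl , le-refl px ∷ All.tabulate x≤
    where x≤ : ∀ {z} → z LM.∈ y ∷ ys → T (le x z)
          x≤ z∈ = le-trans px (All.lookup pys m∈) (All.lookup pys z∈) x≤m (All.lookup m≤ z∈)
  ...   | inj₂ m≤x = m , there m∈ , m≤x ∷ m≤

cross-≤-trans : ∀ a b c x y z .{{_ : NonZero y}} → a * y ≤ b * x → b * z ≤ c * y → a * z ≤ c * x
cross-≤-trans a b c x y z ay≤bx bz≤cy = *-cancelʳ-≤ (a * z) (c * x) y (begin
    a * z * y ≡⟨ xy∙z≈xz∙y a z y ⟩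
    a * y * z ≤⟨ *-monoˡ-≤ z ay≤bx ⟩
    b * x * z ≡⟨ xy∙z≈xz∙y b x z ⟩
    b * z * x ≤⟨ *-monoˡ-≤ x bz≤cy ⟩
    c * y * x ≡⟨ xy∙z≈xz∙y c y x ⟩
    c * x * y ∎)
  where open ≤-Reasoning

⋃[_] : ∀ {A : Set} {n} → (A → Subset n) → List A → Subset n
⋃[ F ] = foldr (λ a s → F a ∪ s) ⊥

module _ {A : Set} {n} (F : A → Subset n) {x : Fin n} where

  ∈-⋃⁺ : ∀ {as} → Any (λ a → x ∈ F a) as → x ∈ ⋃[ F ] as
  ∈-⋃⁺ (here x∈)  = x∈p∪q⁺ (inj₁ x∈)
  ∈-⋃⁺ (there x∈) = x∈p∪q⁺ (inj₂ (∈-⋃⁺ x∈))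

  ∈-⋃⁻ : ∀ as → x ∈ ⋃[ F ] as → Any (λ a → x ∈ F a) as
  ∈-⋃⁻ []       x∈ = ⊥-elim (∉⊥ x∈)
  ∈-⋃⁻ (a ∷ as) x∈ = [ here , there ∘ ∈-⋃⁻ as ] (x∈p∪q⁻ (F a) (⋃[ F ] as) x∈)

  ∉-⋃⁻ : ∀ as → x ∉ ⋃[ F ] as → All (λ a → x ∉ F a) as
  ∉-⋃⁻ as x∉ = ¬Any⇒All¬ as (x∉ ∘ ∈-⋃⁺)

module _ {nR nD : ℕ} where

  private
    E : Set
    E = Edge nR nD

  usedDrivers : List E → Subset nD
  usedDrivers = ⋃[ ⁅_⁆ ∘ driver ]

  VertexDisjoint-sym : ∀ {e f : E} → VertexDisjoint e f → VertexDisjoint f e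
  VertexDisjoint-sym {e} {f} (d≢ , empty) =
    d≢ ∘ sym , subst Empty (∩-comm (riders e) (riders f)) empty

  ¬conflicts⇒VertexDisjoint : ∀ (e f : E) → T (not (conflicts e f)) → VertexDisjoint e f
  ¬conflicts⇒VertexDisjoint e f c
    with driver e F.≟ driver f | _≟S_ {nD = nD} (riders e ∩ riders f) ⊥
  ... | yes _  | _           = ⊥-elim c
  ... | no d≢  | yes empty   = d≢ , λ (x , x∈) → ∉⊥ (subst (x ∈_) empty x∈)
  ... | no _   | no _        = ⊥-elim c

  VertexDisjoint⇒¬conflicts : ∀ (e f : E) → VertexDisjoint e f → T (not (conflicts e f))
  VertexDisjoint⇒¬conflicts e f (d≢ , empty)
    with driver e F.≟ driver f | _≟S_ {nD = nD} (riders e ∩ riders f) ⊥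
  ... | yes d≡ | _         = d≢ d≡
  ... | no _   | yes _     = tt
  ... | no _   | no ≢empty = ≢empty (Empty-unique empty)

  conflicts-refl : ∀ (e : E) → ¬ T (not (conflicts e e))
  conflicts-refl e with driver e F.≟ driver e
  ... | yes _ = λ ()
  ... | no d≢ = ⊥-elim (d≢ refl)

  allᵇ-complete : ∀ (p : E → Bool) xs → All (T ∘ p) xs → T (allᵇ p xs)
  allᵇ-complete p []       []         = tt
  allᵇ-complete p (x ∷ xs) (px ∷ pxs) with p x
  ... | true = allᵇ-complete p xs pxs

  pickIdx-∈ : ∀ i (xs : List E) {e} → pickIdx i xs ≡ just e → e LM.∈ xs
  pickIdx-∈ i xs picked with nth xs i in nth≡
  pickIdx-∈ i xs refl | just _ = nth-∈ xs i nth≡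
    where nth-∈ : ∀ (xs : List E) i {e} → nth xs i ≡ just e → e LM.∈ xs
          nth-∈ (x ∷ xs) zero    refl = here refl
          nth-∈ (x ∷ xs) (suc i) nth≡ = there (nth-∈ xs i nth≡)
  pickIdx-∈ i (x ∷ xs) refl | nothing = here refl

  pickIdx-≢nothing : ∀ i {xs : List E} {x} → x LM.∈ xs → pickIdx i xs ≢ nothing
  pickIdx-≢nothing i {[]}     ()
  pickIdx-≢nothing i {x ∷ xs} _ with nth (x ∷ xs) i
  ... | just _  = λ ()
  ... | nothing = λ ()

  HasMinimizers : (E → E → Bool) → List E → Set
  HasMinimizers le H = ∀ {cur f} → cur ⊆ₗ H → f LM.∈ cur → ∃[ e ] e LM.∈ minimizers le cur

  module _ (le : E → E → Bool) {P : E → Set}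
    (le-total : ∀ {a b} → P a → P b → T (le a b) ⊎ T (le b a))
    (le-trans : ∀ {a b c} → P a → P b → P c → T (le a b) → T (le b c) → T (le a c)) where

    total-preorder⇒HasMinimizers : ∀ {H} → All P H → HasMinimizers le H
    total-preorder⇒HasMinimizers pH {cur = y ∷ ys} cur⊆H _
      with least-exists le le-total le-trans (All.tabulate (All.lookup pH ∘ cur⊆H))
    ... | m , m∈ , m≤ =
      m , ∈-filter⁺ (T? ∘ λ e → allᵇ (le e) (y ∷ ys)) m∈ (allᵇ-complete (le m) _ m≤)

  leWeight-HasMinimizers : ∀ H → HasMinimizers leWeight H
  leWeight-HasMinimizers H = total-preorder⇒HasMinimizers leWeight {P = λ _ → Unit.⊤}
    (λ {a} {b} _ _ → Sum.map fromWitness fromWitness (≤-total (weight a) (weight b)))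
    (λ _ _ _ a≤b b≤c → fromWitness (≤-trans (toWitness a≤b) (toWitness b≤c)))
    (All.universal (λ _ → tt) H)

  leRatio-HasMinimizers : ∀ {H} → All (Nonempty ∘ riders) H → HasMinimizers leRatio H
  leRatio-HasMinimizers nonempty =
    total-preorder⇒HasMinimizers leRatio {P = NonZero ∘ ∣_∣ ∘ riders}
    (λ {a} {b} _ _ → Sum.map fromWitness fromWitness
      (≤-total (weight a * ∣ riders b ∣) (weight b * ∣ riders a ∣)))
    (λ {a} {b} {c} _ nzb _ a≤b b≤c → fromWitness
      (cross-≤-trans (weight a) (weight b) (weight c) _ ∣ riders b ∣ _ {{nzb}}
        (toWitness a≤b) (toWitness b≤c)))
    (All.map (>-nonZero ∘ Nonempty⇒0<∣p∣) nonempty)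

  ReturnsFeasible : List E → Maybe (List E) → Set
  ReturnsFeasible H result = ∃[ M ] (result ≡ just M × Feasible H M)

  dropConflicts : E → List E → List E
  dropConflicts e = filterᵇ (λ f → not (conflicts e f))

  dropConflicts-shrinks : ∀ {e} cur → e LM.∈ cur → length (dropConflicts e cur) < length cur
  dropConflicts-shrinks {e} cur e∈ =
    filter-notAll (T? ∘ λ f → not (conflicts e f)) cur (LM.lose e∈ (conflicts-refl e))

  record Invariant (H cur M : List E) : Set where
    field
      selected⊆H        : All (LM._∈ H) M
      selected-disjoint : AllPairs VertexDisjoint M
      current⊆H         : cur ⊆ₗ H
      current-disjoint  : ∀ {f} → f LM.∈ cur → All (VertexDisjoint f) M
      current-complete  : ∀ {f} → f LM.∈ H → All (VertexDisjoint f) M → f LM.∈ cur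
      drivers≤riders    : ∣ usedDrivers M ∣ ≤ ∣ coveredBy M ∣

  module _ {H : List E} (nonempty : All (Nonempty ∘ riders) H) where

    Invariant-initial : Invariant H H []
    Invariant-initial = record
      { selected⊆H        = []
      ; selected-disjoint = []
      ; current⊆H         = id
      ; current-disjoint  = λ _ → []
      ; current-complete  = λ f∈H _ → f∈H
      ; drivers≤riders    = ≤-reflexive (trans (∣⊥∣≡0 nD) (sym (∣⊥∣≡0 nR)))
      }

    Invariant-step : ∀ {cur M e} → Invariant H cur M → e LM.∈ cur
                   → Invariant H (dropConflicts e cur) (e ∷ M)
    Invariant-step {cur} {M} {e} inv e∈ = record
      { selected⊆H        = current⊆H e∈ ∷ selected⊆H
      ; selected-disjoint = current-disjoint e∈ ∷ selected-disjoint
      ; current⊆H         = current⊆H ∘ proj₁ ∘ ∈-filter⁻ keep? {xs = cur}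
      ; current-disjoint  = λ {f} f∈ → let f∈cur , kept = ∈-filter⁻ keep? {xs = cur} f∈ in
          VertexDisjoint-sym {e} {f} (¬conflicts⇒VertexDisjoint e f kept) ∷ current-disjoint f∈cur
      ; current-complete  = λ { {f} f∈H (f#e ∷ f#M) → ∈-filter⁺ keep? (current-complete f∈H f#M)
          (VertexDisjoint⇒¬conflicts e f (VertexDisjoint-sym {f} {e} f#e)) }
      ; drivers≤riders    = counting
      }
      where
      open Invariant inv
      keep? : ∀ f → Dec (T (not (conflicts e f)))
      keep? f = T? (not (conflicts e f))

      new-rider : ∃[ x ] (x ∈ riders e × x ∉ coveredBy M)
      new-rider with All.lookup nonempty (current⊆H e∈)
      ... | x , x∈e =
        x , x∈e , All¬⇒¬Any (All.map (λ {m} → x∉ {m}) (current-disjoint e∈)) ∘ ∈-⋃⁻ riders M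
        where x∉ : ∀ {m} → VertexDisjoint e m → x ∉ riders m
              x∉ (_ , empty) x∈m = empty (x , x∈p∩q⁺ (x∈e , x∈m))

      counting : ∣ ⁅ driver e ⁆ ∪ usedDrivers M ∣ ≤ ∣ riders e ∪ coveredBy M ∣
      counting with x , x∈e , x∉C ← new-rider = begin
        ∣ ⁅ driver e ⁆ ∪ usedDrivers M ∣        ≤⟨ ∣p∪q∣≤∣p∣+∣q∣ ⁅ driver e ⁆ (usedDrivers M) ⟩
        ∣ ⁅ driver e ⁆ ∣ + ∣ usedDrivers M ∣    ≡⟨ cong (_+ ∣ usedDrivers M ∣) (∣⁅x⁆∣≡1 (driver e)) ⟩
        suc ∣ usedDrivers M ∣                   ≤⟨ s≤s drivers≤riders ⟩
        suc ∣ coveredBy M ∣                     ≤⟨ p⊂q⇒∣p∣<∣q∣ C⊂e∪C ⟩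
        ∣ riders e ∪ coveredBy M ∣              ∎
        where
        open ≤-Reasoning
        C⊂e∪C : coveredBy M ⊂ riders e ∪ coveredBy M
        C⊂e∪C = q⊆p∪q (riders e) (coveredBy M) , x , x∈p∪q⁺ (inj₁ x∈e) , x∉C

    module _ (le : E → E → Bool) (minimizers-exist : HasMinimizers le H)
      (progress : ∀ {cur M} → Invariant H cur M → coveredBy M ≢ ⊤ → ∃[ f ] f LM.∈ cur)
      (tb : ℕ → ℕ) where

      greedyLoop-feasible : ∀ fuel it {cur M} → Invariant H cur M → length cur ≤ fuel
                          → ReturnsFeasible H (greedyLoop le tb fuel it cur M)
      greedyLoop-feasible fuel it {cur} {M} inv len with _≟S_ {nD = nD} (coveredBy M) ⊤
      ... | yes covered = M , refl , selected⊆H , selected-disjoint ,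
                          λ r → ∈-⋃⁻ riders M (subst (r ∈_) (sym covered) ∈⊤)
        where open Invariant inv
      ... | no uncovered with progress inv uncovered
      ...   | f , f∈ with fuel
      ...     | zero = ⊥-elim (<⇒≱ (∈-length f∈) len)
      ...     | suc fuel′ with pickIdx (tb it) (minimizers le cur) in picked
      ...       | nothing = ⊥-elim (pickIdx-≢nothing (tb it)
                              (proj₂ (minimizers-exist (Invariant.current⊆H inv) f∈)) picked)
      ...       | just e = greedyLoop-feasible fuel′ (suc it) (Invariant-step inv e∈)
                             (≤-pred (≤-trans (dropConflicts-shrinks cur e∈) len))
        where e∈ : e LM.∈ cur
              e∈ = proj₁ (∈-filter⁻ (T? ∘ λ g → allᵇ (le g) cur) (pickIdx-∈ (tb it) _ picked))

      greedyRun-feasible : ReturnsFeasible H (greedyRun le tb H)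
      greedyRun-feasible = greedyLoop-feasible (length H) 0 Invariant-initial ≤-refl

  uncovered⇒current-nonempty : ∀ {H : List E} (Δ : Subset nD) → ∣ Δ ∣ ≡ nR
    → (∀ η → η ∈ Δ → ∀ r → ∃[ e ] (e LM.∈ H × driver e ≡ η × riders e ≡ ⁅ r ⁆))
    → ∀ {cur M} → Invariant H cur M → coveredBy M ≢ ⊤ → ∃[ f ] f LM.∈ cur
  uncovered⇒current-nonempty Δ ∣Δ∣≡nR designated {M = M} inv uncovered
    with r , r∉C ← ¬∀⟶∃¬ nR (_∈ coveredBy M) (_∈? coveredBy M)
                     (λ all → uncovered (⊆-antisym ⊆⊤ (λ {x} _ → all x)))
    with η , η∈Δ , η∉U ← ∣p∣<∣q∣⇒∃∈q∖p (≤-<-trans (Invariant.drivers≤riders inv)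
                            (subst (∣ coveredBy M ∣ <_) (sym ∣Δ∣≡nR) (x∉p⇒∣p∣<n r∉C)))
    with f , f∈H , f-driver , f-riders ← designated η η∈Δ r
    = f , current-complete f∈H
            (All.zipWith (λ {m} → disjoint {m}) (∉-⋃⁻ (⁅_⁆ ∘ driver) M η∉U , ∉-⋃⁻ riders M r∉C))
    where
    open Invariant inv

    disjoint : ∀ {m} → η ∉ ⁅ driver m ⁆ × r ∉ riders m → VertexDisjoint f m
    disjoint {m} (η∉m , r∉m) =
      (λ f≡m → η∉m (subst (λ d → η ∈ ⁅ d ⁆) (trans (sym f-driver) f≡m) (x∈⁅x⁆ η))) ,
      λ (x , x∈) → let x∈f , x∈m = x∈p∩q⁻ (riders f) (riders m) x∈ in
        r∉m (subst (_∈ riders m) (x∈⁅y⁆⇒x≡y r (subst (x ∈_) f-riders x∈f)) x∈m)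

GreedyMinDist-feasible : ∀ {nR nD} {H : List (Edge nR nD)} tb1 tb2
  → ReturnsFeasible H (greedyRun leWeight tb1 H) → ReturnsFeasible H (greedyRun leRatio tb2 H)
  → ReturnsFeasible H (GreedyMinDist tb1 tb2 H)
GreedyMinDist-feasible _ _ (M₁ , run₁ , feasible₁) (M₂ , run₂ , feasible₂)
  rewrite run₁ | run₂ with ⌊ totalWeight M₁ ≤? totalWeight M₂ ⌋
... | true  = M₁ , refl , feasible₁
... | false = M₂ , refl , feasible₂

lemma3 : {nR nD : ℕ} (cap : Fin nD → ℕ) (Δ : Subset nD) (H : List (Edge nR nD))
       → WellFormed cap H
       → ∣ Δ ∣ ≡ nR
       → (∀ (η : Fin nD) → η ∈ Δ → ∀ (r : Fin nR)
            → ∃[ e ] (e LM.∈ H × driver e ≡ η × riders e ≡ ⁅ r ⁆))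
       → (tb1 tb2 : ℕ → ℕ)
       → ∃[ M ] (GreedyMinDist tb1 tb2 H ≡ just M × Feasible H M)
lemma3 cap Δ H (edge-conditions , _) ∣Δ∣≡nR designated tb1 tb2 =
  GreedyMinDist-feasible tb1 tb2
    (greedyRun-feasible nonempty leWeight (leWeight-HasMinimizers H) progress tb1)
    (greedyRun-feasible nonempty leRatio (leRatio-HasMinimizers nonempty) progress tb2)
  where
  nonempty : All (Nonempty ∘ riders) H
  nonempty = All.map proj₁ edge-conditions

  progress : ∀ {cur M} → Invariant H cur M → coveredBy M ≢ ⊤ → ∃[ f ] f LM.∈ cur
  progress = uncovered⇒current-nonempty Δ ∣Δ∣≡nR designated
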